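{- Let $\mathcal{C} = \{c_{1},\ldots, c_{n} \}$ be a coin set with $c_1<\cdots<c_n$. If $\mathcal{C}$ is completely greedy and totally unique, then for all $1\le k \le n$ and $0 \le i \le k - 1$, $c_{k} \ge 2^{i}c_{k-i}$.
   Context: A coin set is a set of positive integers containing $1$; a sub-coin set is a subset containing $1$. A representation of a positive integer $m$ in $\mathcal{C}$ is $m=\sum_{c\in\mathcal{C}}\alpha_c c$ with $\alpha_c\in\mathbb{N}$; it is minimal if $\sum_c\alpha_c$ is minimized. The greedy representation repeatedly subtracts the largest coin not exceeding the remaining amount. A coin set is greedy if the greedy representation is minimal for every positive integer, and completely greedy if all its sub-coin sets are greedy. A coin set is unique if every positive integer has exactly one minimal representation (i.e. exactly one minimizing coefficient vector $(\alpha_c)$). $\mathcal{C}=\{c_1<\dots<c_n\}$ is totally unique if $\{c_1,\ldots,c_k\}$ is unique for every $1\le k\le n$. -}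

module Defs where

open import Data.Nat using (ℕ; zero; suc; _+_; _*_; _∸_; _≤_; _<_)
open import Data.Nat.DivMod using (_/_; _%_)
open import Data.List using (List; []; _∷_; length; zipWith; reverse; take)
open import Data.Nat.ListAction using (sum)
open import Data.List.Membership.Propositional using (_∈_)
open import Data.List.Relation.Binary.Sublist.Propositional using (_⊆_)
open import Data.List.Relation.Unary.Linked using (Linked)
open import Data.Product using (Σ; _×_)
open import Relation.Binary.PropositionalEquality using (_≡_)

-- A coin set C = {c₁ < … < cₙ} is represented by the list [c₁, …, cₙ],
-- strictly increasing, containing 1 (hence c₁ = 1 and all coins positive).
CoinSet : List ℕ → Set
CoinSet cs = Linked _<_ cs × (1 ∈ cs)

-- k-th coin, 1-indexed (c₁ = coin cs 1); default 0 out of range.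
coin : List ℕ → ℕ → ℕ
coin []       _             = 0
coin (c ∷ cs) zero          = 0
coin (c ∷ cs) (suc zero)    = c
coin (c ∷ cs) (suc (suc k)) = coin cs (suc k)

-- A coefficient vector α for cs is a list of naturals of the same length;
-- α lists the multiplicities α_c in the order of the coins.
value : List ℕ → List ℕ → ℕ
value cs α = sum (zipWith _*_ α cs)

size : List ℕ → ℕ
size α = sum α

IsRep : List ℕ → ℕ → List ℕ → Set
IsRep cs m α = (length α ≡ length cs) × (value cs α ≡ m)

IsMinRep : List ℕ → ℕ → List ℕ → Set
IsMinRep cs m α = IsRep cs m α × (∀ β → IsRep cs m β → size α ≤ size β)

-- Greedy algorithm on coins listed in decreasing order: repeatedly
-- subtracting the largest coin c ≤ (remaining amount) uses that coin
-- exactly (amount / c) times and leaves (amount % c).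
greedyDesc : List ℕ → ℕ → List ℕ
greedyDesc []            m = []
greedyDesc (zero  ∷ ds)  m = 0 ∷ greedyDesc ds m
greedyDesc (suc c ∷ ds)  m = (m / suc c) ∷ greedyDesc ds (m % suc c)

greedy : List ℕ → ℕ → List ℕ
greedy cs m = reverse (greedyDesc (reverse cs) m)

IsGreedy : List ℕ → Set
IsGreedy cs = ∀ m → 1 ≤ m → IsMinRep cs m (greedy cs m)

SubCoinSet : List ℕ → List ℕ → Set
SubCoinSet ds cs = (ds ⊆ cs) × (1 ∈ ds)

CompletelyGreedy : List ℕ → Set
CompletelyGreedy cs = ∀ ds → SubCoinSet ds cs → IsGreedy ds

IsUnique : List ℕ → Set
IsUnique cs = ∀ m → 1 ≤ m →
  Σ (List ℕ) (λ α → IsMinRep cs m α × (∀ β → IsMinRep cs m β → β ≡ α))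

TotallyUnique : List ℕ → Set
TotallyUnique cs = ∀ k → 1 ≤ k → k ≤ length cs → IsUnique (take k cs)

-- If two consecutive coins a < b had b < 2a, then a ≥ 2, so the coin 1 lies before a.
-- The greedy algorithm on the sub-coin set {1, a, b} pays 2a as b + (2a − b)·1, and its
-- minimality forces b = 2a − 1.  But then, in the prefix of the coin set ending with b,
-- the amount 2a exceeds every coin and has the two distinct two-coin representations
-- a + a and 1 + b, contradicting uniqueness.  Hence c_{j+1} ≥ 2c_j for all j, and the
-- bound follows by iterating.
module Submission where

open import Defs
open import Data.Nat using (ℕ; zero; suc; _+_; _*_; _^_; _∸_; _≤_; _<_; z≤n; s≤s; s≤s⁻¹; _<?_)
open import Data.Nat.Properties
open import Data.Nat.DivMod
  using (_/_; _%_; n/1≡n; m<n⇒m%n≡m; m<n⇒m/n≡0; m/n≡1+[m∸n]/n; m≤n⇒[n∸m]%m≡n%m)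
open import Data.Nat.ListAction.Properties using (sum-++)
open import Data.List using (List; []; _∷_; _++_; length; take; replicate; reverse)
open import Data.List.Properties using (length-++; reverse-++)
open import Data.List.Membership.Propositional using (_∈_)
open import Data.List.Relation.Unary.Any using (here; there)
import Data.List.Relation.Unary.Any.Properties as Any
open import Data.List.Relation.Unary.All using (All; []; _∷_)
import Data.List.Relation.Unary.All as All
import Data.List.Relation.Unary.All.Properties as All
open import Data.List.Relation.Unary.AllPairs using (AllPairs; []; _∷_)
import Data.List.Relation.Unary.AllPairs as AllPairs
open import Data.List.Relation.Unary.Linked.Properties using (Linked⇒AllPairs)
open import Data.List.Relation.Binary.Sublist.Propositional using (_⊆_; ⊆-refl; from∈)
open import Data.List.Relation.Binary.Sublist.Propositional.Properties using (++⁺; ++⁺ʳ)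
open import Data.Product using (∃₂; _,_; proj₁; proj₂)
open import Data.Sum using (inj₁; inj₂)
open import Data.Empty using (⊥-elim)
open import Relation.Nullary using (¬_; yes; no)
open import Relation.Binary.PropositionalEquality

AllPairs-++⁻ʳ : ∀ {A : Set} {R : A → A → Set} xs {ys} → AllPairs R (xs ++ ys) → AllPairs R ys
AllPairs-++⁻ʳ []       p       = p
AllPairs-++⁻ʳ (_ ∷ xs) (_ ∷ p) = AllPairs-++⁻ʳ xs p

AllPairs-prefix-below : ∀ {A : Set} {R : A → A → Set} xs {a ys} →
                        AllPairs R (xs ++ a ∷ ys) → All (λ x → R x a) xs
AllPairs-prefix-below []       _       = []
AllPairs-prefix-below (_ ∷ xs) (h ∷ p) = All.head (All.++⁻ʳ xs h) ∷ AllPairs-prefix-below xs p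

∈-sorted-prefix : ∀ xs {a ys x} → AllPairs _<_ (xs ++ a ∷ ys) → x < a →
                  x ∈ xs ++ a ∷ ys → x ∈ xs
∈-sorted-prefix xs sorted x<a x∈ with Any.++⁻ xs x∈
... | inj₁ x∈xs        = x∈xs
... | inj₂ (here refl) = ⊥-elim (<-irrefl refl x<a)
... | inj₂ (there x∈ys) =
  ⊥-elim (<-asym x<a (All.lookup (AllPairs.head (AllPairs-++⁻ʳ xs sorted)) x∈ys))

take-++-length : ∀ {A : Set} (xs : List A) {ys} n → take (length xs + n) (xs ++ ys) ≡ xs ++ take n ys
take-++-length []       n = refl
take-++-length (x ∷ xs) n = cong (x ∷_) (take-++-length xs n)

split-at-consecutive : ∀ cs j → 1 ≤ j → suc j ≤ length cs →
                       ∃₂ λ xs ys → cs ≡ xs ++ coin cs j ∷ coin cs (suc j) ∷ ys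
split-at-consecutive (c ∷ d ∷ ys) 1             _ _         = [] , ys , refl
split-at-consecutive (c ∷ cs)     (suc (suc j)) _ (s≤s j<n)
  with split-at-consecutive cs (suc j) (s≤s z≤n) j<n
... | xs , ys , eq = c ∷ xs , ys , cong (c ∷_) eq

value-++ : ∀ xs us {ys vs} → length us ≡ length xs →
           value (xs ++ ys) (us ++ vs) ≡ value xs us + value ys vs
value-++ []       []       _  = refl
value-++ (x ∷ xs) (u ∷ us) eq =
  trans (cong (u * x +_) (value-++ xs us (suc-injective eq))) (sym (+-assoc (u * x) _ _))

IsRep-++ : ∀ {xs ys m n} us vs → IsRep xs m us → IsRep ys n vs →
           IsRep (xs ++ ys) (m + n) (us ++ vs)
IsRep-++ {xs} {ys} us vs (|us| , refl) (|vs| , refl) =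
  trans (length-++ us) (trans (cong₂ _+_ |us| |vs|) (sym (length-++ xs))) ,
  value-++ xs us |us|

zeroRep : List ℕ → List ℕ
zeroRep cs = replicate (length cs) 0

zeroRep-isRep : ∀ cs → IsRep cs 0 (zeroRep cs)
zeroRep-isRep []       = refl , refl
zeroRep-isRep (c ∷ cs) = cong suc (proj₁ (zeroRep-isRep cs)) , proj₂ (zeroRep-isRep cs)

size-zeroRep : ∀ cs → size (zeroRep cs) ≡ 0
size-zeroRep []       = refl
size-zeroRep (_ ∷ cs) = size-zeroRep cs

unitRep : ∀ {x cs} → x ∈ cs → List ℕ
unitRep {cs = _ ∷ cs} (here _)  = 1 ∷ zeroRep cs
unitRep               (there q) = 0 ∷ unitRep q

unitRep-isRep : ∀ {x cs} (q : x ∈ cs) → IsRep cs x (unitRep q)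
unitRep-isRep {cs = c ∷ cs} (here refl) =
  cong suc (proj₁ (zeroRep-isRep cs)) ,
  trans (cong₂ _+_ (*-identityˡ c) (proj₂ (zeroRep-isRep cs))) (+-identityʳ c)
unitRep-isRep (there q) = cong suc (proj₁ (unitRep-isRep q)) , proj₂ (unitRep-isRep q)

size-unitRep : ∀ {x cs} (q : x ∈ cs) → size (unitRep q) ≡ 1
size-unitRep {cs = _ ∷ cs} (here _) = cong suc (size-zeroRep cs)
size-unitRep (there q)              = size-unitRep q

value≤size*max : ∀ {M} cs α → All (_≤ M) cs → value cs α ≤ size α * M
value≤size*max     []       []      _            = z≤n
value≤size*max     []       (_ ∷ _) _            = z≤n
value≤size*max     (_ ∷ _)  []      _            = z≤n
value≤size*max {M} (c ∷ cs) (u ∷ α) (c≤M ∷ cs≤M) = begin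
  u * c + value cs α     ≤⟨ +-mono-≤ (*-monoʳ-≤ u c≤M) (value≤size*max cs α cs≤M) ⟩
  u * M + size α * M     ≡⟨ *-distribʳ-+ M u (size α) ⟨
  (u + size α) * M       ∎
  where open ≤-Reasoning

-- An amount larger than every coin needs at least two coins.
size-two-rep-minimal : ∀ {M cs m} → All (_≤ M) cs → M < m →
                       ∀ α → IsRep cs m α → size α ≡ 2 → IsMinRep cs m α
size-two-rep-minimal {M} {cs} {m} coins≤M M<m α rep |α|≡2 =
  rep , λ β β-rep → subst (_≤ size β) (sym |α|≡2) (two≤size β β-rep)
  where
  two≤size : ∀ β → IsRep cs m β → 2 ≤ size β
  two≤size β (_ , refl) = ≮⇒≥ λ size<2 → <⇒≱ M<m (begin
    value cs β      ≤⟨ value≤size*max cs β coins≤M ⟩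
    size β * M      ≤⟨ *-monoˡ-≤ M (s≤s⁻¹ size<2) ⟩
    1 * M           ≡⟨ *-identityˡ M ⟩
    M               ∎)
    where open ≤-Reasoning

minRep-unique : ∀ {cs m α β} → IsUnique cs → 1 ≤ m →
                IsMinRep cs m α → IsMinRep cs m β → α ≡ β
minRep-unique U 1≤m α-min β-min with U _ 1≤m
... | _ , _ , only = trans (only _ α-min) (sym (only _ β-min))

greedy-1ab : ∀ {a b m} → b ≤ m → m ∸ b < a → a < b →
             greedy (1 ∷ a ∷ b ∷ []) m ≡ m ∸ b ∷ 0 ∷ 1 ∷ []
greedy-1ab {suc a-1} {b@(suc _)} {m} b≤m r<a a<b = begin
  ((m % b) % a) / 1 ∷ (m % b) / a ∷ m / b ∷ []
    ≡⟨ cong (λ r → (r % a) / 1 ∷ r / a ∷ m / b ∷ []) m%b≡r ⟩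
  (r % a) / 1 ∷ r / a ∷ m / b ∷ []
    ≡⟨ cong₂ (λ s q → s ∷ q ∷ m / b ∷ []) r%a/1≡r (m<n⇒m/n≡0 r<a) ⟩
  r ∷ 0 ∷ m / b ∷ []
    ≡⟨ cong (λ q → r ∷ 0 ∷ q ∷ []) m/b≡1 ⟩
  r ∷ 0 ∷ 1 ∷ []
    ∎
  where
  open ≡-Reasoning
  a = suc a-1
  r = m ∸ b
  r<b : r < b
  r<b = <-trans r<a a<b
  m%b≡r : m % b ≡ r
  m%b≡r = trans (sym (m≤n⇒[n∸m]%m≡n%m b≤m)) (m<n⇒m%n≡m r<b)
  r%a/1≡r : (r % a) / 1 ≡ r
  r%a/1≡r = trans (n/1≡n (r % a)) (m<n⇒m%n≡m r<a)
  m/b≡1 : m / b ≡ 1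
  m/b≡1 = trans (m/n≡1+[m∸n]/n b≤m) (cong suc (m<n⇒m/n≡0 r<b))

-- Minimality of the greedy payment b + (2a − b)·1 of 2a, against a + a.
greedy-1ab⇒2a≡1+b : ∀ {a b} → IsGreedy (1 ∷ a ∷ b ∷ []) → a < b → b < 2 * a →
                    2 * a ≡ 1 + b
greedy-1ab⇒2a≡1+b {a} {b} G a<b b<2a with G (2 * a) (≤-trans (s≤s z≤n) b<2a)
... | _ , minimal = begin
  2 * a            ≡⟨ m∸n+n≡m (<⇒≤ b<2a) ⟨
  2 * a ∸ b + b    ≡⟨ cong (_+ b) (≤-antisym d≤1 (m<n⇒0<n∸m b<2a)) ⟩
  1 + b            ∎
  where
  open ≡-Reasoning
  d = 2 * a ∸ b
  d<a : d < a
  d<a = subst (d <_) (m+n∸n≡m a b)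
          (∸-monoˡ-< (subst (_< a + b) (cong (a +_) (sym (+-identityʳ a))) (+-monoʳ-< a a<b))
                     (<⇒≤ b<2a))
  d≤1 : d ≤ 1
  d≤1 = s≤s⁻¹ (subst (_≤ 2) (+-comm d 1)
          (subst (λ g → size g ≤ 2) (greedy-1ab (<⇒≤ b<2a) d<a a<b)
            (minimal (0 ∷ 2 ∷ 0 ∷ []) (refl , +-identityʳ (2 * a)))))

a<b<2a⇒1<a : ∀ {a b} → a < b → b < 2 * a → 1 < a
a<b<2a⇒1<a {suc zero} (s≤s (s≤s _)) (s≤s (s≤s ()))
a<b<2a⇒1<a {suc (suc _)} _ _ = s≤s (s≤s z≤n)

last-two-differ : ∀ us vs → us ++ 2 ∷ 0 ∷ [] ≢ vs ++ 0 ∷ 1 ∷ []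
last-two-differ us vs eq
  with trans (sym (reverse-++ us _)) (trans (cong reverse eq) (reverse-++ vs _))
... | ()

2a≡1+b⇒¬IsUnique : ∀ xs {a b} → 1 ∈ xs → All (_≤ b) xs → a < b → 2 * a ≡ 1 + b →
                    ¬ IsUnique (xs ++ a ∷ b ∷ [])
2a≡1+b⇒¬IsUnique xs {a} {b} 1∈xs xs≤b a<b 2a≡1+b U =
  last-two-differ (zeroRep xs) (unitRep 1∈xs)
    (minRep-unique U (≤-trans (s≤s z≤n) b<2a)
      (minimal (zeroRep xs ++ 2 ∷ 0 ∷ []) twoA twoA-size)
      (minimal (unitRep 1∈xs ++ 0 ∷ 1 ∷ []) oneB oneB-size))
  where
  b<2a : b < 2 * a
  b<2a = subst (b <_) (sym 2a≡1+b) (n<1+n b)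
  minimal : ∀ α → IsRep (xs ++ a ∷ b ∷ []) (2 * a) α → size α ≡ 2 →
            IsMinRep (xs ++ a ∷ b ∷ []) (2 * a) α
  minimal = size-two-rep-minimal (All.++⁺ xs≤b (<⇒≤ a<b ∷ ≤-refl ∷ [])) b<2a
  twoA-rep : IsRep (a ∷ b ∷ []) (2 * a) (2 ∷ 0 ∷ [])
  twoA-rep = refl , +-identityʳ (2 * a)
  twoA : IsRep (xs ++ a ∷ b ∷ []) (2 * a) (zeroRep xs ++ 2 ∷ 0 ∷ [])
  twoA = IsRep-++ (zeroRep xs) (2 ∷ 0 ∷ []) (zeroRep-isRep xs) twoA-rep
  twoA-size : size (zeroRep xs ++ 2 ∷ 0 ∷ []) ≡ 2
  twoA-size = trans (sum-++ (zeroRep xs) _) (cong (_+ 2) (size-zeroRep xs))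
  b-rep : IsRep (a ∷ b ∷ []) b (0 ∷ 1 ∷ [])
  b-rep = refl , trans (+-identityʳ (b + 0)) (+-identityʳ b)
  oneB : IsRep (xs ++ a ∷ b ∷ []) (2 * a) (unitRep 1∈xs ++ 0 ∷ 1 ∷ [])
  oneB = subst (λ m → IsRep (xs ++ a ∷ b ∷ []) m (unitRep 1∈xs ++ 0 ∷ 1 ∷ [])) (sym 2a≡1+b)
           (IsRep-++ (unitRep 1∈xs) (0 ∷ 1 ∷ []) (unitRep-isRep 1∈xs) b-rep)
  oneB-size : size (unitRep 1∈xs ++ 0 ∷ 1 ∷ []) ≡ 2
  oneB-size = trans (sum-++ (unitRep 1∈xs) _) (cong (_+ 1) (size-unitRep 1∈xs))

consecutive-coins-double : ∀ xs {a b} ys → CoinSet (xs ++ a ∷ b ∷ ys) →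
                           CompletelyGreedy (xs ++ a ∷ b ∷ ys) →
                           TotallyUnique (xs ++ a ∷ b ∷ ys) → 2 * a ≤ b
consecutive-coins-double xs {a} {b} ys (linked , 1∈cs) CG TU with b <? 2 * a
... | no b≮2a  = ≮⇒≥ b≮2a
... | yes b<2a = ⊥-elim (2a≡1+b⇒¬IsUnique xs 1∈xs xs≤b a<b 2a≡1+b prefix-unique)
  where
  sorted : AllPairs _<_ (xs ++ a ∷ b ∷ ys)
  sorted = Linked⇒AllPairs <-trans linked
  a<b : a < b
  a<b = All.head (AllPairs.head (AllPairs-++⁻ʳ xs sorted))
  1∈xs : 1 ∈ xs
  1∈xs = ∈-sorted-prefix xs sorted (a<b<2a⇒1<a a<b b<2a) 1∈cs
  xs≤b : All (_≤ b) xs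
  xs≤b = All.map (λ x<a → <⇒≤ (<-trans x<a a<b)) (AllPairs-prefix-below xs sorted)
  1ab⊆cs : (1 ∷ a ∷ b ∷ []) ⊆ xs ++ a ∷ b ∷ ys
  1ab⊆cs = ++⁺ (from∈ 1∈xs) (++⁺ʳ ys ⊆-refl)
  2a≡1+b : 2 * a ≡ 1 + b
  2a≡1+b = greedy-1ab⇒2a≡1+b (CG _ (1ab⊆cs , here refl)) a<b b<2a
  prefix-unique : IsUnique (xs ++ a ∷ b ∷ [])
  prefix-unique = subst IsUnique (take-++-length xs 2)
    (TU (length xs + 2) (≤-trans (s≤s z≤n) (m≤n+m 2 (length xs)))
        (subst (length xs + 2 ≤_) (sym (length-++ xs)) (+-monoʳ-≤ (length xs) (s≤s (s≤s z≤n)))))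

coin-doubles : ∀ {cs} → CoinSet cs → CompletelyGreedy cs → TotallyUnique cs →
               ∀ j → 1 ≤ j → suc j ≤ length cs → 2 * coin cs j ≤ coin cs (suc j)
coin-doubles {cs} CS CG TU j 1≤j j<|cs| with split-at-consecutive cs j 1≤j j<|cs|
... | xs , ys , eq = consecutive-coins-double xs ys
  (subst CoinSet eq CS) (subst CompletelyGreedy eq CG) (subst TotallyUnique eq TU)

doubling⇒geometric : ∀ {L} (f : ℕ → ℕ) → (∀ j → 1 ≤ j → suc j ≤ L → 2 * f j ≤ f (suc j)) →
                     ∀ j i → 1 ≤ j → j + i ≤ L → 2 ^ i * f j ≤ f (j + i)
doubling⇒geometric f double j zero _ _ =
  ≤-reflexive (trans (*-identityˡ (f j)) (cong f (sym (+-identityʳ j))))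
doubling⇒geometric {L} f double j (suc i) 1≤j j+1+i≤L = begin
  2 ^ suc i * f j    ≡⟨ *-assoc 2 (2 ^ i) (f j) ⟩
  2 * (2 ^ i * f j)  ≤⟨ *-monoʳ-≤ 2 (doubling⇒geometric f double j i 1≤j j+i≤L) ⟩
  2 * f (j + i)      ≤⟨ double (j + i) (≤-trans 1≤j (m≤m+n j i)) 1+j+i≤L ⟩
  f (suc (j + i))    ≡⟨ cong f (+-suc j i) ⟨
  f (j + suc i)      ∎
  where
  open ≤-Reasoning
  1+j+i≤L : suc (j + i) ≤ L
  1+j+i≤L = subst (_≤ L) (+-suc j i) j+1+i≤L
  j+i≤L : j + i ≤ L
  j+i≤L = <⇒≤ 1+j+i≤L

lemma5 : (cs : List ℕ) → CoinSet cs → CompletelyGreedy cs → TotallyUnique cs →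
         ∀ k i → 1 ≤ k → k ≤ length cs → i ≤ k ∸ 1 →
         2 ^ i * coin cs (k ∸ i) ≤ coin cs k
lemma5 cs CS CG TU (suc k) i _ k≤|cs| i≤k =
  subst (λ n → 2 ^ i * coin cs (suc k ∸ i) ≤ coin cs n) k-i+i≡k
    (doubling⇒geometric (coin cs) (coin-doubles CS CG TU) (suc k ∸ i) i
      (m<n⇒0<n∸m (s≤s i≤k)) (subst (_≤ length cs) (sym k-i+i≡k) k≤|cs|))
  where
  k-i+i≡k : suc k ∸ i + i ≡ suc k
  k-i+i≡k = m∸n+n≡m (m≤n⇒m≤1+n i≤k)
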